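{- Let $n\ge2$, $k\ge3$, $\varepsilon>0$ and let $f:S_k^n\to[k]$ be a social choice function with $\mathbf{D}(f,\overline{\mathrm{NONMANIP}})\ge\varepsilon$, and let $a\ne b$ be alternatives. Suppose $\sigma\in\bigcup_{z\in\{ -1,1\}^n}\partial(B_1^{a,b}(z))$. Then either $\sigma_{ -1}\in D_1(a,b)$, or there exists a manipulation point $\hat\sigma$ of $f$ which differs from $\sigma$ in at most two coordinates, one of which is the first coordinate.
   Context: $S_k$ is the set of total orderings of $[k]$; a social choice function is $f:S_k^n\to[k]$; $\sigma_{ -1}=(\sigma_2,\dots,\sigma_n)$. $\sigma$ is a manipulation point of $f$ if some $\sigma'$ differing from $\sigma$ only in a coordinate $i$ has $f(\sigma')$ ranked above $f(\sigma)$ by $\sigma_i$. $\overline{\mathrm{NONMANIP}}$ is the set of SCFs depending on only one coordinate or taking at most two values; $\mathbf{D}(f,G)=\min_{g\in G}\mathbb{P}(f(\sigma)\ne g(\sigma))$. $B_1^{a,b}$ is the set of pairs $(\sigma,\sigma')$ differing exactly in coordinate $1$ with $f(\sigma)=a$, $f(\sigma')=b$. $x^{a,b}(\sigma)\in\{ -1,1\}^n$ has $x^{a,b}_j(\sigma)=1$ iff $\sigma_j$ ranks $a$ above $b$. $F^{a,b}(z)=\{\sigma:x^{a,b}(\sigma)=z\}$, $B_1^{a,b}(z)=\{\sigma\in F^{a,b}(z): f(\sigma)=a,\ \exists\sigma'\text{ with }(\sigma,\sigma')\in B_1^{a,b}\}$, and $\partial(B_1^{a,b}(z))$ is the set of $\sigma\in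 B_1^{a,b}(z)$ for which some $\pi\in F^{a,b}(z)\setminus B_1^{a,b}(z)$ differs from $\sigma$ in exactly one coordinate. For nonempty $H\subseteq[k]$, $\mathrm{top}_H$ maps a ranking to its highest-ranked element of $H$. $D_1^H=\{\sigma_{ -1}: f(\tau,\sigma_{ -1})=\mathrm{top}_H(\tau)\ \text{for all }\tau\in S_k\}$ and $D_1(a,b)=\bigcup_{H\supseteq\{a,b\},\,|H|\ge3}D_1^H$.
   Formalization: The parameter ε ranges over the positive rationals. -}

module Defs where

open import Data.Nat as ℕ using (ℕ; zero; suc; s≤s; z≤n)
open import Data.Fin as Fin using (Fin; zero; suc; _≟_)
open import Data.Fin.Subset using (Subset; _∈_; ∣_∣)
open import Data.Fin.Subset.Properties using (_∈?_)
open import Data.Bool using (Bool; true; false; T; _∧_)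
open import Data.Maybe using (Maybe; just; nothing)
open import Data.List as List using (List; []; _∷_; length; filter; mapMaybe; concatMap; map; allFin)
open import Data.Vec as Vec using (Vec; []; _∷_; lookup; _[_]≔_)
open import Data.Product using (Σ; ∃; ∃-syntax; _×_; _,_; proj₁)
open import Data.Sum using (_⊎_)
open import Relation.Nullary using (¬_; does; yes; no; ¬?)
open import Relation.Nullary.Decidable using (T?)
open import Relation.Binary.PropositionalEquality using (_≡_; _≢_)
open import Function.Bundles using (_⇔_)
import Data.Vec.Membership.DecPropositional as VMem
import Data.Bool.ListAction as BL
open import Data.Rational as ℚ using (ℚ; 0ℚ)
open import Data.Integer using (+_)

-- Rankings (total orders on the k alternatives Fin k)
-- A ranking is a vector listing all k alternatives from top (index 0)
-- to bottom, each exactly once.  The side condition is a boolean so that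
-- the proof component is irrelevant (T true = ⊤).

isPerm : ∀ {k} → Vec (Fin k) k → Bool
isPerm {k} v = BL.all (λ a → does (a ∈ᵥ? v)) (allFin k)
  where open VMem (_≟_ {k}) renaming (_∈?_ to _∈ᵥ?_)

Ranking : ℕ → Set
Ranking k = Σ (Vec (Fin k) k) (λ v → T (isPerm v))

Above : ∀ {k} → Ranking k → Fin k → Fin k → Set
Above {k} r a b = ∃[ i ] ∃[ j ] (i Fin.< j × lookup (proj₁ r) i ≡ a × lookup (proj₁ r) j ≡ b)

-- top_H(τ) : the highest-ranked element of H according to τ
-- (nothing only when H is empty)
firstIn : ∀ {k m} → Subset k → Vec (Fin k) m → Maybe (Fin k)
firstIn H [] = nothing
firstIn H (x ∷ xs) with x ∈? H
... | yes _ = just x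
... | no _  = firstIn H xs

top : ∀ {k} → Subset k → Ranking k → Maybe (Fin k)
top H τ = firstIn H (proj₁ τ)

Profile : ℕ → ℕ → Set
Profile n k = Vec (Ranking k) n

SCF : ℕ → ℕ → Set
SCF n k = Profile n k → Fin k

AgreeExcept : ∀ {n k} → Fin n → Profile n k → Profile n k → Set
AgreeExcept i σ σ' = ∀ j → j ≢ i → lookup σ j ≡ lookup σ' j

DifferInExactlyOne : ∀ {n k} → Profile n k → Profile n k → Set
DifferInExactlyOne σ σ' = ∃[ i ] (AgreeExcept i σ σ' × lookup σ i ≢ lookup σ' i)

ManipulationPoint : ∀ {n k} → SCF n k → Profile n k → Set
ManipulationPoint f σ =
  ∃[ i ] ∃[ σ' ] (AgreeExcept i σ σ' × Above (lookup σ i) (f σ') (f σ))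

NonManip : ∀ {n k} → SCF n k → Set
NonManip {n} {k} g =
  (∃[ i ] (∀ σ σ' → lookup σ i ≡ lookup σ' i → g σ ≡ g σ'))
  ⊎ (∃[ x ] ∃[ y ] (∀ σ → g σ ≡ x ⊎ g σ ≡ y))

-- Uniform probability on S_k^n via explicit enumeration

vecsOf : ∀ {A : Set} → List A → (m : ℕ) → List (Vec A m)
vecsOf xs zero = [] ∷ []
vecsOf xs (suc m) = concatMap (λ x → map (x ∷_) (vecsOf xs m)) xs

toRanking : ∀ {k} → Vec (Fin k) k → Maybe (Ranking k)
toRanking v with T? (isPerm v)
... | yes p = just (v , p)
... | no _  = nothing

allRankings : ∀ k → List (Ranking k)
allRankings k = mapMaybe toRanking (vecsOf (allFin k) k)

allProfiles : ∀ n k → List (Profile n k)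
allProfiles n k = vecsOf (allRankings k) n

disagreeCount : ∀ {n k} → SCF n k → SCF n k → ℕ
disagreeCount {n} {k} f g =
  length (filter (λ σ → ¬? (f σ ≟ g σ)) (allProfiles n k))

-- D(f, NONMANIP-bar) ≥ ε, i.e. for every g in NONMANIP-bar,
-- P(f σ ≠ g σ) ≥ ε  (written as  ε · |S_k^n| ≤ #{σ : f σ ≠ g σ})
DistNonManipAtLeast : ∀ {n k} → SCF n k → ℚ → Set
DistNonManipAtLeast {n} {k} f ε =
  ∀ (g : SCF n k) → NonManip g →
    ε ℚ.* (+ length (allProfiles n k) ℚ./ 1) ℚ.≤ (+ disagreeCount f g ℚ./ 1)

-- The sets F^{a,b}(z), B_1^{a,b}(z), ∂ B_1^{a,b}(z), D_1(a,b)
-- z ∈ {-1,1}^n is encoded as Vec Bool n with true ↔ 1.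

first : ∀ {n} → 2 ℕ.≤ n → Fin n
first (s≤s _) = zero

InF : ∀ {n k} → Fin k → Fin k → Vec Bool n → Profile n k → Set
InF a b z σ = ∀ j → (lookup z j ≡ true) ⇔ Above (lookup σ j) a b

InB1 : ∀ {n k} → 2 ℕ.≤ n → SCF n k → Fin k → Fin k → Vec Bool n → Profile n k → Set
InB1 h f a b z σ =
  InF a b z σ × f σ ≡ a × (∃[ σ' ] (AgreeExcept (first h) σ σ' × f σ' ≡ b))

InBoundaryB1 : ∀ {n k} → 2 ℕ.≤ n → SCF n k → Fin k → Fin k → Vec Bool n → Profile n k → Set
InBoundaryB1 h f a b z σ =
  InB1 h f a b z σ ×
  (∃[ π ] (InF a b z π × ¬ InB1 h f a b z π × DifferInExactlyOne σ π))

-- σ_{-1} ∈ D_1^H  (σ_{-1} is represented by σ; its first coordinate is ignored)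
InD1H : ∀ {n k} → 2 ℕ.≤ n → SCF n k → Subset k → Profile n k → Set
InD1H {k = k} h f H σ = ∀ (τ : Ranking k) → just (f (σ [ first h ]≔ τ)) ≡ top H τ

InD1 : ∀ {n k} → 2 ℕ.≤ n → SCF n k → Fin k → Fin k → Profile n k → Set
InD1 {k = k} h f a b σ =
  ∃[ H ] (a ∈ H × b ∈ H × 3 ℕ.≤ ∣ H ∣ × InD1H h f H σ)

module Submission where

-- Write σ = (s₀, ss) and let σ′ = (q₀, ss) be the first-voter deviation
-- witnessing σ ∈ B₁^{a,b}(z), so f σ = a and f σ′ = b.  A "nearby manipulation"
-- is a manipulation point differing from σ only in voter 1 and one more voter;
-- every step below either establishes its claim or exhibits one.  For an alternative c let g(c) be the outcome
-- when voter 1 ranks c on top, the others voting as in σ; c is *fixed* if g(c) = c.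
-- Every outcome of a first-voter deviation from σ is fixed; in particular a, b are.
--  * If a third alternative is fixed, the set H of fixed alternatives has at least
--    three elements and every first-voter deviation τ yields top_H(τ), so
--    σ₋₁ ∈ D₁^H ⊆ D₁(a,b).
--  * Otherwise first-voter deviations yield a or b, as voter 1 orders them.  The
--    boundary neighbour π of σ then yields an a/b exchange between two profiles,
--    or a third outcome at a profile differing from σ in voter 1 and one voter j;
--    a chain of switches between rankings with prescribed top two alternatives
--    turns the latter into a manipulation point (module ThirdOutcome).

open import Defs
open import Data.Nat using (ℕ; zero; suc; _≤_; s≤s; z≤n)
open import Data.Nat.Properties using (≤-trans)
open import Data.Fin as Fin using (Fin; zero; suc; _≟_)
open import Data.Fin.Properties using (<-cmp; suc-injective)
import Data.Fin.Permutation.Components as PC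
open import Data.Fin.Subset using (Subset; _∈_; _∉_; ∣_∣; _-_)
open import Data.Fin.Subset.Properties using (_∈?_; x∈p⇒∣p-x∣<∣p∣; x∈p∧x≢y⇒x∈p-y)
open import Data.Bool using (Bool; true; false; T)
open import Data.Bool.Properties using (T-irrelevant)
open import Data.Maybe using (just)
open import Data.Vec using (Vec; []; _∷_; lookup; tabulate; _[_]≔_)
open import Data.Vec.Properties
  using (lookup∘tabulate; tabulate∘lookup; tabulate-cong; lookup∘updateAt; lookup∘updateAt′;
         lookup⇒[]=; []=⇒lookup)
open import Data.Vec.Membership.Propositional.Properties using (∈-lookup)
import Data.Vec.Relation.Unary.Any as VAny
open import Data.Vec.Relation.Unary.Any.Properties using (lookup-index)
import Data.Vec.Membership.DecPropositional as VMem
import Data.List as List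
import Data.List.Relation.Unary.All as All
open import Data.List.Relation.Unary.All.Properties using (all⁺; all⁻)
open import Data.List.Membership.Propositional.Properties using (∈-allFin)
open import Data.Product using (∃-syntax; _×_; _,_; proj₁; proj₂)
open import Data.Sum using (_⊎_; inj₁; inj₂; [_,_]′; map₁; map₂; reduce)
open import Data.Empty using (⊥-elim)
open import Function using (_∘_; id)
open import Function.Bundles using (Equivalence)
open import Relation.Nullary using (Dec; yes; no; does; ¬_; contradiction)
open import Relation.Nullary.Decidable using (dec-true; dec-false; T?)
open import Relation.Binary.Definitions using (tri<; tri≈; tri>)
open import Relation.Binary.PropositionalEquality
  using (_≡_; _≢_; refl; sym; trans; cong; subst; ≢-sym; module ≡-Reasoning)
open import Data.Rational using (ℚ; 0ℚ; _<_)
open import Level using (0ℓ)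
open import Effect.Monad using (RawMonad)

_at_ : ∀ {k} → Ranking k → Fin k → Fin k
r at q = lookup (proj₁ r) q

does⇒ : ∀ {A : Set} (d : Dec A) → T (does d) → A
does⇒ (yes a) _ = a

⇒does : ∀ {A : Set} (d : Dec A) → A → T (does d)
⇒does (yes _) _ = _
⇒does (no ¬a) a = ¬a a

module _ {k : ℕ} where
  open VMem (_≟_ {k}) using () renaming (_∈_ to _∈ᵥ_; _∈?_ to _∈ᵥ?_)

  position : (r : Ranking k) (x : Fin k) → ∃[ q ] r at q ≡ x
  position (v , perm) x = VAny.index x∈v , sym (lookup-index x∈v)
    where
    x∈v : x ∈ᵥ v
    x∈v = does⇒ (x ∈ᵥ? v) (All.lookup (all⁺ _ _ perm) (∈-allFin x))

  ranking : (v : Vec (Fin k) k) → (∀ x → ∃[ q ] lookup v q ≡ x) → Ranking k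
  ranking v occurs =
    v , all⁻ (λ x → does (x ∈ᵥ? v)) {List.allFin k} (All.tabulate λ {x} _ → ⇒does (x ∈ᵥ? v) (x∈v x))
    where
    x∈v : ∀ x → x ∈ᵥ v
    x∈v x = let (q , e) = occurs x in subst (_∈ᵥ v) e (∈-lookup q v)

above-top : ∀ {k} (r : Ranking (suc k)) {x d} → r at zero ≡ x → d ≢ x → Above r x d
above-top r {x} {d} r₀ d≢x with position r d
... | zero  , e = contradiction (trans (sym e) r₀) d≢x
... | suc q , e = zero , suc q , s≤s z≤n , r₀ , e

above-second : ∀ {k} (r : Ranking (suc (suc k))) {w x d} →
  r at zero ≡ w → r at suc zero ≡ x → d ≢ w → d ≢ x → Above r x d
above-second r {d = d} r₀ r₁ d≢w d≢x with position r d
... | zero        , e = contradiction (trans (sym e) r₀) d≢w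
... | suc zero    , e = contradiction (trans (sym e) r₁) d≢x
... | suc (suc q) , e = suc zero , suc (suc q) , s≤s (s≤s z≤n) , r₁ , e

above-total : ∀ {k} (r : Ranking k) {x y} → x ≢ y → Above r x y ⊎ Above r y x
above-total r {x} {y} x≢y with position r x | position r y
... | qx , ex | qy , ey with <-cmp qx qy
...   | tri< qx<qy _ _ = inj₁ (qx , qy , qx<qy , ex , ey)
...   | tri≈ _ refl _  = contradiction (trans (sym ex) ey) x≢y
...   | tri> _ _ qy<qx = inj₂ (qy , qx , qy<qx , ey , ex)

transpose-at : ∀ {n} (i j : Fin n) → PC.transpose i j i ≡ j
transpose-at i j rewrite dec-true (i ≟ i) refl = refl

transpose-fixes : ∀ {n} {i j q : Fin n} → q ≢ i → q ≢ j → PC.transpose i j q ≡ q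
transpose-fixes {i = i} {j} {q} q≢i q≢j rewrite dec-false (q ≟ i) q≢i | dec-false (q ≟ j) q≢j = refl

module _ {k : ℕ} where
  exchangeAt : Ranking k → Fin k → Fin k → Ranking k
  exchangeAt r p q = ranking (tabulate (λ i → r at PC.transpose p q i)) occurs
    where
    open ≡-Reasoning
    occurs : ∀ x → ∃[ i ] lookup (tabulate (λ i → r at PC.transpose p q i)) i ≡ x
    occurs x = PC.transpose q p i , (begin
        lookup (tabulate (λ i → r at PC.transpose p q i)) (PC.transpose q p i)
          ≡⟨ lookup∘tabulate _ (PC.transpose q p i) ⟩
        r at PC.transpose p q (PC.transpose q p i)
          ≡⟨ cong (r at_) (PC.transpose-inverse p q) ⟩
        r at i
          ≡⟨ eq ⟩
        x ∎)
      where
      i : Fin k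
      i = proj₁ (position r x)
      eq : r at i ≡ x
      eq = proj₂ (position r x)

  -- move alternative x to position p by an exchange; only the two facts below
  -- about it are used, so it is kept abstract
  abstract
    bringTo : Fin k → Fin k → Ranking k → Ranking k
    bringTo p x r = exchangeAt r p (proj₁ (position r x))

    bringTo-at : ∀ p x r → bringTo p x r at p ≡ x
    bringTo-at p x r = trans (lookup∘tabulate _ p)
      (trans (cong (r at_) (transpose-at p _)) (proj₂ (position r x)))

    bringTo-elsewhere : ∀ {p x q} r → q ≢ p → r at q ≢ x → bringTo p x r at q ≡ r at q
    bringTo-elsewhere {p} {x} {q} r q≢p rq≢x = trans (lookup∘tabulate _ q)
      (cong (r at_) (transpose-fixes q≢p λ q≡m → rq≢x (trans (cong (r at_) q≡m) (proj₂ (position r x)))))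

  identityRanking : Ranking k
  identityRanking = ranking (tabulate id) (λ x → x , lookup∘tabulate id x)

module _ {k : ℕ} where
  atTop : Fin (suc k) → Ranking (suc k)
  atTop x = bringTo zero x identityRanking

  atTop-top : ∀ x → atTop x at zero ≡ x
  atTop-top x = bringTo-at zero x identityRanking

module _ {k : ℕ} where
  lead : Fin (suc (suc k)) → Fin (suc (suc k)) → Ranking (suc (suc k))
  lead x y = bringTo (suc zero) y (atTop x)

  lead-top : ∀ {x y} → x ≢ y → lead x y at zero ≡ x
  lead-top {x} {y} x≢y = trans
    (bringTo-elsewhere {p = suc zero} {y} {zero} (atTop x) (λ ())
      (λ x≡y → x≢y (trans (sym (atTop-top x)) x≡y)))
    (atTop-top x)

  lead-second : ∀ x y → lead x y at suc zero ≡ y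
  lead-second x y = bringTo-at (suc zero) y (atTop x)

  lead-above₁ : ∀ {x y d} → x ≢ y → d ≢ x → Above (lead x y) x d
  lead-above₁ {x} {y} x≢y = above-top (lead x y) (lead-top x≢y)

  lead-above₂ : ∀ {x y d} → x ≢ y → d ≢ x → d ≢ y → Above (lead x y) y d
  lead-above₂ {x} {y} x≢y = above-second (lead x y) (lead-top x≢y) (lead-second x y)

-- Exhaustive search over finite types

-- A type is searchable when a pointwise alternative "P x or Q" can be turned
-- into "P everywhere or Q"; this is how the dichotomies of the proof are decided.
Searchable : Set → Set₁
Searchable A = ∀ {Q : Set} (P : A → Set) → (∀ x → P x ⊎ Q) → (∀ x → P x) ⊎ Q

search-Fin : ∀ n → Searchable (Fin n)
search-Fin zero    P decide = inj₁ λ ()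
search-Fin (suc n) P decide with decide zero | search-Fin n (P ∘ suc) (decide ∘ suc)
... | inj₂ q  | _       = inj₂ q
... | inj₁ _  | inj₂ q  = inj₂ q
... | inj₁ p₀ | inj₁ ps = inj₁ λ { zero → p₀ ; (suc x) → ps x }

search-Vec : ∀ {A} → Searchable A → ∀ n → Searchable (Vec A n)
search-Vec sA zero P decide = map₁ (λ p → λ { [] → p }) (decide [])
search-Vec sA (suc n) P decide =
  map₁ (λ p → λ { (x ∷ xs) → p x xs })
       (sA (λ x → ∀ xs → P (x ∷ xs)) λ x → search-Vec sA n (P ∘ (x ∷_)) (decide ∘ (x ∷_)))

-- rankings are searchable: their permutation condition is a decidable,
-- proof-irrelevant property of the underlying vector
search-Ranking : ∀ k → Searchable (Ranking k)
search-Ranking k {Q} P decide =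
  map₁ (λ p → λ { (v , t) → p v t })
       (search-Vec (search-Fin k) k (λ v → (t : T (isPerm v)) → P (v , t)) decideVec)
  where
  decideVec : ∀ v → (∀ (t : T (isPerm v)) → P (v , t)) ⊎ Q
  decideVec v with T? (isPerm v)
  ... | no ¬t = inj₁ λ t → contradiction t ¬t
  ... | yes t = map₁ (λ p t′ → subst (λ t → P (v , t)) (T-irrelevant t t′) p) (decide (v , t))

three≤∣_∣ : ∀ {n} (p : Subset n) {x y w} → x ∈ p → y ∈ p → w ∈ p →
  x ≢ y → x ≢ w → y ≢ w → 3 ≤ ∣ p ∣
three≤∣ p ∣ {x} {y} {w} x∈p y∈p w∈p x≢y x≢w y≢w =
  ≤-trans (s≤s (≤-trans (s≤s w-nonempty) drop-y)) drop-x
  where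
  drop-x : suc ∣ p - x ∣ ≤ ∣ p ∣
  drop-x = x∈p⇒∣p-x∣<∣p∣ x∈p
  drop-y : suc ∣ p - x - y ∣ ≤ ∣ p - x ∣
  drop-y = x∈p⇒∣p-x∣<∣p∣ (x∈p∧x≢y⇒x∈p-y y∈p (≢-sym x≢y))
  w-nonempty : 1 ≤ ∣ p - x - y ∣
  w-nonempty = ≤-trans (s≤s z≤n)
    (x∈p⇒∣p-x∣<∣p∣ (x∈p∧x≢y⇒x∈p-y (x∈p∧x≢y⇒x∈p-y w∈p (≢-sym x≢w)) (≢-sym y≢w)))

firstIn-spec : ∀ {k m} (H : Subset k) (v : Vec (Fin k) m) →
  (∀ q → lookup v q ∉ H) ⊎
  ∃[ q ] (firstIn H v ≡ just (lookup v q) × lookup v q ∈ H × (∀ q′ → q′ Fin.< q → lookup v q′ ∉ H))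
firstIn-spec H [] = inj₁ λ ()
firstIn-spec H (x ∷ v) with x ∈? H
... | yes x∈H = inj₂ (zero , refl , x∈H , λ _ ())
... | no  x∉H with firstIn-spec H v
...   | inj₁ none = inj₁ λ { zero → x∉H ; (suc q) → none q }
...   | inj₂ (q , first≡ , q∈H , before) =
        inj₂ (suc q , first≡ , q∈H , λ { zero _ → x∉H ; (suc q′) (s≤s q′<q) → before q′ q′<q })

top-spec : ∀ {k} {H : Subset k} {a} → a ∈ H → (τ : Ranking k) →
  ∃[ q ] (top H τ ≡ just (τ at q) × τ at q ∈ H × (∀ q′ → q′ Fin.< q → τ at q′ ∉ H))
top-spec {H = H} {a} a∈H τ with firstIn-spec H (proj₁ τ)
... | inj₁ none = let (q , τq≡a) = position τ a in
  contradiction (subst (_∈ H) (sym τq≡a) a∈H) (none q)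
... | inj₂ first = first

module _ {n k : ℕ} where
  agree-refl : ∀ {i} (P : Profile n k) → AgreeExcept i P P
  agree-refl _ _ _ = refl

  agree-sym : ∀ {i} {P P′ : Profile n k} → AgreeExcept i P P′ → AgreeExcept i P′ P
  agree-sym ag j j≢i = sym (ag j j≢i)

  agree-trans : ∀ {i} {P P′ P″ : Profile n k} →
    AgreeExcept i P P′ → AgreeExcept i P′ P″ → AgreeExcept i P P″
  agree-trans ag ag′ j j≢i = trans (ag j j≢i) (ag′ j j≢i)

  agree-update : ∀ i (P : Profile n k) r → AgreeExcept i (P [ i ]≔ r) P
  agree-update i P r j j≢i = lookup∘updateAt′ j i j≢i P

agree-head : ∀ {n k} {r r′ : Ranking k} {P : Profile n k} → AgreeExcept zero (r ∷ P) (r′ ∷ P)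
agree-head zero    0≢0 = contradiction refl 0≢0
agree-head (suc j) _   = refl

agree-cons : ∀ {n k} {j} {r : Ranking k} {P P′ : Profile n k} →
  AgreeExcept j P P′ → AgreeExcept (suc j) (r ∷ P) (r ∷ P′)
agree-cons ag zero    _  = refl
agree-cons ag (suc m) ne = ag m (ne ∘ cong suc)

agree-head⁻¹ : ∀ {n k} {r r′ : Ranking k} {P P′ : Profile n k} →
  AgreeExcept zero (r ∷ P) (r′ ∷ P′) → P ≡ P′
agree-head⁻¹ {P = P} {P′} ag = begin
  P                    ≡⟨ tabulate∘lookup P ⟨
  tabulate (lookup P)  ≡⟨ tabulate-cong (λ j → ag (suc j) λ ()) ⟩
  tabulate (lookup P′) ≡⟨ tabulate∘lookup P′ ⟩
  P′                   ∎
  where open ≡-Reasoning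

agree-cons⁻¹ : ∀ {n k} {j} {r r′ : Ranking k} {P P′ : Profile n k} →
  AgreeExcept (suc j) (r ∷ P) (r′ ∷ P′) → r ≡ r′ × AgreeExcept j P P′
agree-cons⁻¹ ag = ag zero (λ ()) , λ m m≢j → ag (suc m) (m≢j ∘ suc-injective)

-- Manipulation by a single voter, for an arbitrary social choice function

SameOrder : ∀ {k} → Ranking k → Ranking k → Fin k → Fin k → Set
SameOrder r r′ x y = (Above r x y × Above r′ x y) ⊎ (Above r y x × Above r′ y x)

module _ {n k : ℕ} (f : SCF n k) where
  deviation : ∀ {i x y} P P′ → AgreeExcept i P P′ → f P′ ≡ x → f P ≡ y →
    Above (lookup P i) x y → ManipulationPoint f P
  deviation {i} P P′ ag refl refl x≻y = i , P′ , ag , x≻y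

  exchange : ∀ {i x y} P P′ → AgreeExcept i P P′ → f P ≡ x → f P′ ≡ y →
    SameOrder (lookup P i) (lookup P′ i) x y → ManipulationPoint f P ⊎ ManipulationPoint f P′
  exchange P P′ ag fP fP′ (inj₁ (_ , x≻′y)) =
    inj₂ (deviation P′ P (agree-sym {P = P} {P′} ag) fP fP′ x≻′y)
  exchange P P′ ag fP fP′ (inj₂ (y≻x , _)) = inj₁ (deviation P P′ ag fP′ fP y≻x)

sameOrder : ∀ {n k} {x y : Fin k} {z} (P P′ : Profile n k) → x ≢ y →
  InF x y z P → InF x y z P′ → ∀ j → SameOrder (lookup P j) (lookup P′ j) x y
sameOrder {x = x} {y} {z} P P′ x≢y F F′ j with lookup z j in zj
... | true  = inj₁ (Equivalence.to (F j) zj , Equivalence.to (F′ j) zj)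
... | false = inj₂ (y-above {P} F , y-above {P′} F′)
  where
  y-above : ∀ {P} → InF x y z P → Above (lookup P j) y x
  y-above {P} F with above-total (lookup P j) x≢y
  ... | inj₁ x≻y = contradiction (trans (sym zj) (Equivalence.from (F j) x≻y)) λ ()
  ... | inj₂ y≻x = y≻x

module _ {n k : ℕ} (f : SCF n (suc k)) where
  topStable : ∀ {i x} P P′ → AgreeExcept i P P′ → lookup P i at zero ≡ x → f P′ ≡ x →
    f P ≡ x ⊎ ManipulationPoint f P
  topStable {i} {x} P P′ ag top fP′ with f P ≟ x
  ... | yes fP = inj₁ fP
  ... | no  fP≢x = inj₂ (deviation f P P′ ag fP′ refl (above-top (lookup P i) top fP≢x))

module _ {n k : ℕ} (f : SCF n (suc (suc k))) where
  secondStable : ∀ {i w x} P P′ → AgreeExcept i P P′ →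
    lookup P i at zero ≡ w → lookup P i at suc zero ≡ x → f P′ ≡ x →
    (f P ≡ x ⊎ f P ≡ w) ⊎ ManipulationPoint f P
  secondStable {i} {w} {x} P P′ ag top second fP′ with f P ≟ x | f P ≟ w
  ... | yes fP | _     = inj₁ (inj₁ fP)
  ... | no  _  | yes fP = inj₁ (inj₂ fP)
  ... | no  fP≢x | no fP≢w =
    inj₂ (deviation f P P′ ag fP′ refl (above-second (lookup P i) top second fP≢w fP≢x))

-- The argument for a fixed profile σ = (s₀, ss) in B₁^{a,b}

module Boundary {m k : ℕ} (f : SCF (suc (suc m)) (suc (suc k)))
  {a b : Fin (suc (suc k))} (a≢b : a ≢ b)
  (s₀ q₀ : Ranking (suc (suc k))) (ss : Profile (suc m) (suc (suc k)))
  (fσ : f (s₀ ∷ ss) ≡ a) (fσ′ : f (q₀ ∷ ss) ≡ b) where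

  σ : Profile (suc (suc m)) (suc (suc k))
  σ = s₀ ∷ ss

  two≤n : 2 ≤ suc (suc m)
  two≤n = s≤s (s≤s z≤n)

  Near : Profile (suc (suc m)) (suc (suc k)) → Set
  Near σ̂ = ∃[ j ] (∀ i → i ≢ zero → i ≢ j → lookup σ̂ i ≡ lookup σ i)

  NearManipulation : Set
  NearManipulation = ∃[ σ̂ ] (ManipulationPoint f σ̂ × Near σ̂)

  near : ∀ {j} r {P} → AgreeExcept j P ss → Near (r ∷ P)
  near {j} r P~ss = suc j , λ
    { zero    0≢0 _   → contradiction refl 0≢0
    ; (suc i) _   i≢j → P~ss i (i≢j ∘ cong suc) }

  nearby : ∀ {j r P} {A : Set} → AgreeExcept j P ss →
    A ⊎ ManipulationPoint f (r ∷ P) → A ⊎ NearManipulation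
  nearby {r = r} {P} P~ss = map₂ λ mp → r ∷ P , mp , near r P~ss

  nearby₁ : ∀ {r} {A : Set} → A ⊎ ManipulationPoint f (r ∷ ss) → A ⊎ NearManipulation
  nearby₁ {r} = nearby {j = zero} {r} {ss} (agree-refl ss)

  settle : ∀ j {r r′} P P′ → AgreeExcept j P ss → AgreeExcept j P′ ss →
    ManipulationPoint f (r ∷ P) ⊎ ManipulationPoint f (r′ ∷ P′) → NearManipulation
  settle _ _ _ P~ss P′~ss =
    [ (λ mp → reduce (nearby P~ss (inj₂ mp))) , (λ mp → reduce (nearby P′~ss (inj₂ mp))) ]′

  -- "this fact, or a manipulation point near σ" is a monad
  open import Data.Sum.Effectful.Right 0ℓ NearManipulation using (monad)
  open RawMonad monad using (_>>=_; pure)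

  topOutcome : Fin (suc (suc k)) → Fin (suc (suc k))
  topOutcome c = f (atTop c ∷ ss)

  -- the outcome c of a first-voter deviation r from σ is fixed, since otherwise
  -- voter 1 at atTop c could switch to r and obtain her top alternative
  fixedOrManipulable : ∀ {r c} → f (r ∷ ss) ≡ c → topOutcome c ≡ c ⊎ NearManipulation
  fixedOrManipulable {r} {c} frc =
    nearby₁ (topStable f (atTop c ∷ ss) (r ∷ ss) agree-head (atTop-top c) frc)

  classify : ∀ x → x ≡ a ⊎ x ≡ b ⊎ (x ≢ a × x ≢ b)
  classify x with x ≟ a | x ≟ b
  ... | yes x≡a | _       = inj₁ x≡a
  ... | no  _   | yes x≡b = inj₂ (inj₁ x≡b)
  ... | no  x≢a | no  x≢b = inj₂ (inj₂ (x≢a , x≢b))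

  -- Case 1: a third alternative is fixed

  isFixed : Fin (suc (suc k)) → Bool
  isFixed d = does (topOutcome d ≟ d)

  fixedSet : Subset (suc (suc k))
  fixedSet = tabulate isFixed

  fixed⇒∈ : ∀ {d} → topOutcome d ≡ d → d ∈ fixedSet
  fixed⇒∈ {d} fixed =
    lookup⇒[]= d fixedSet (trans (lookup∘tabulate isFixed d) (dec-true (topOutcome d ≟ d) fixed))

  ∈⇒fixed : ∀ {d} → d ∈ fixedSet → topOutcome d ≡ d
  ∈⇒fixed {d} d∈H = does⇒ (topOutcome d ≟ d)
    (subst T (trans (sym ([]=⇒lookup d∈H)) (lookup∘tabulate isFixed d)) _)

  -- every first-voter deviation τ yields top_H(τ) for H the fixed set: if τ
  -- ranked top_H(τ) higher, voter 1 would move it to the top; if τ ranked the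
  -- (unfixed) outcome y higher, voter 1 at atTop y would switch to τ
  followsTop : a ∈ fixedSet → ∀ τ → just (f (τ ∷ ss)) ≡ top fixedSet τ ⊎ NearManipulation
  followsTop a∈H τ with top-spec a∈H τ | position τ (f (τ ∷ ss))
  ... | q , top≡ , x∈H , before | qy , τqy≡y with <-cmp q qy
  ...   | tri< q<qy _ _ = nearby₁ (inj₂ (deviation f (τ ∷ ss) (atTop (τ at q) ∷ ss)
            agree-head (∈⇒fixed x∈H) (sym τqy≡y) (q , qy , q<qy , refl , refl)))
  ...   | tri≈ _ refl _ = inj₁ (trans (cong just (sym τqy≡y)) (sym top≡))
  ...   | tri> _ _ qy<q = nearby₁ (inj₂ (deviation f (atTop y ∷ ss) (τ ∷ ss)
            agree-head refl refl (above-top (atTop y) (atTop-top y) unfixed)))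
    where
    y : Fin (suc (suc k))
    y = f (τ ∷ ss)
    unfixed : topOutcome y ≢ y
    unfixed fixed = before qy qy<q (subst (_∈ fixedSet) (sym τqy≡y) (fixed⇒∈ fixed))

  dictatorial : ∀ {c} → c ≢ a → c ≢ b → topOutcome c ≡ c → InD1 two≤n f a b σ ⊎ NearManipulation
  dictatorial c≢a c≢b fixed-c = do
    fixed-a ← fixedOrManipulable fσ
    fixed-b ← fixedOrManipulable fσ′
    let a∈H = fixed⇒∈ fixed-a
        b∈H = fixed⇒∈ fixed-b
        three = three≤∣ fixedSet ∣ a∈H b∈H (fixed⇒∈ fixed-c) a≢b (≢-sym c≢a) (≢-sym c≢b)
    map₁ (λ d₁ → fixedSet , a∈H , b∈H , three , d₁)
         (search-Ranking _ _ (followsTop a∈H))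

  -- Case 2: no third alternative is fixed

  module TwoValued (noThird : ∀ c → c ≡ a ⊎ c ≡ b ⊎ topOutcome c ≢ c) where

    outcomeAB : ∀ r → (f (r ∷ ss) ≡ a ⊎ f (r ∷ ss) ≡ b) ⊎ NearManipulation
    outcomeAB r with noThird (f (r ∷ ss))
    ... | inj₁ fa                = pure (inj₁ fa)
    ... | inj₂ (inj₁ fb)         = pure (inj₂ fb)
    ... | inj₂ (inj₂ unfixed)    = do
      fixed ← fixedOrManipulable refl
      contradiction fixed unfixed

    followsA : ∀ r → Above r a b → f (r ∷ ss) ≡ a ⊎ NearManipulation
    followsA r a≻b = outcomeAB r >>=
      [ pure , (λ fb → nearby₁ (inj₂ (deviation f (r ∷ ss) σ agree-head fσ fb a≻b))) ]′

    followsB : ∀ r → Above r b a → f (r ∷ ss) ≡ b ⊎ NearManipulation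
    followsB r b≻a = outcomeAB r >>=
      [ (λ fa → nearby₁ (inj₂ (deviation f (r ∷ ss) (q₀ ∷ ss) agree-head fσ′ fa b≻a))) , pure ]′

    -- The profiles examined have
    -- voter 1 ranking two of a, b, c on top, and voter j either as in ss or
    -- ranking lead x c for x ∈ {a, b} (the profile ρ x).  Following a chain of
    -- unilateral switches, ρ a makes lead b a yield a, ρ b makes lead a b yield
    -- b, while at ss they yield b and a; voter j then gains by switching to ρ a
    -- or ρ b, according to her order of a and b in σ.
    module ThirdOutcome {j : Fin (suc m)} {cs : Profile (suc m) (suc (suc k))} (cs~ss : AgreeExcept j cs ss)
      {r₀ c} (fc : f (r₀ ∷ cs) ≡ c) (c≢a : c ≢ a) (c≢b : c ≢ b) where

      ρ : Fin (suc (suc k)) → Profile (suc m) (suc (suc k))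
      ρ x = ss [ j ]≔ lead x c

      ρ~ss : ∀ x → AgreeExcept j (ρ x) ss
      ρ~ss x = agree-update j ss (lead x c)

      ss~ρ : ∀ x → AgreeExcept j ss (ρ x)
      ss~ρ x = agree-sym {P = ρ x} {ss} (ρ~ss x)

      ρ~cs : ∀ x → AgreeExcept j (ρ x) cs
      ρ~cs x = agree-trans {P = ρ x} {ss} {cs} (ρ~ss x) (agree-sym {P = cs} {ss} cs~ss)

      ρ-top : ∀ {x} → x ≢ c → lookup (ρ x) j at zero ≡ x
      ρ-top {x} x≢c = trans (cong (_at zero) (lookup∘updateAt j ss)) (lead-top x≢c)

      ρ-second : ∀ x → lookup (ρ x) j at suc zero ≡ c
      ρ-second x = trans (cong (_at suc zero) (lookup∘updateAt j ss)) (lead-second x c)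

      keepsC : ∀ {x} → c ≢ x → f (lead c x ∷ cs) ≡ c ⊎ NearManipulation
      keepsC {x} c≢x =
        nearby cs~ss (topStable f (lead c x ∷ cs) (r₀ ∷ cs) agree-head (lead-top c≢x) fc)

      chain : ∀ {x y} → x ≢ y → c ≢ x → c ≢ y →
        (∀ r → Above r x y → f (r ∷ ss) ≡ x ⊎ NearManipulation) →
        f (lead c y ∷ cs) ≡ c → f (lead y x ∷ ρ x) ≡ x ⊎ NearManipulation
      chain {x} {y} x≢y c≢x c≢y followsX fcy = do
        -- voter 1 at lead c x: x at ss, and x after voter j moves x to the top
        x-at-ss ← followsX (lead c x) (lead-above₂ c≢x (≢-sym c≢y) (≢-sym x≢y))
        x-at-ρ ← nearby (ρ~ss x) (topStable f (lead c x ∷ ρ x) (lead c x ∷ ss)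
                   (agree-cons (ρ~ss x)) (ρ-top (≢-sym c≢x)) x-at-ss)
        -- voter 1 at lead c y: voter j could return to cs and obtain c, her second choice;
        -- but outcome c here would let voter 1 at lead c x obtain c
        inj₂ x-at-ρ′ ← nearby (ρ~ss x) (secondStable f (lead c y ∷ ρ x) (lead c y ∷ cs)
                   (agree-cons (ρ~cs x)) (ρ-top (≢-sym c≢x)) (ρ-second x) fcy)
          where inj₁ c-at-ρ → do
                  c-at-ρ′ ← nearby (ρ~ss x) (topStable f (lead c x ∷ ρ x) (lead c y ∷ ρ x)
                              agree-head (lead-top c≢x) c-at-ρ)
                  contradiction (trans (sym c-at-ρ′) x-at-ρ) c≢x
        -- voter 1 at lead y x: she could obtain x, her second choice, by switching
        -- to lead c y; outcome y here would let voter 1 at lead c y obtain y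
        inj₂ y-at-ρ ← nearby (ρ~ss x) (secondStable f (lead y x ∷ ρ x) (lead c y ∷ ρ x)
                   agree-head (lead-top (≢-sym x≢y)) (lead-second y x) x-at-ρ′)
          where inj₁ done → pure done
        nearby (ρ~ss x) (inj₂ (deviation f (lead c y ∷ ρ x) (lead y x ∷ ρ x)
          agree-head y-at-ρ x-at-ρ′ (lead-above₂ c≢y (≢-sym c≢x) x≢y)))

      swing : ∀ {x y} → Above (lookup ss j) x y →
        f (lead y x ∷ ss) ≡ y → f (lead y x ∷ ρ x) ≡ x → NearManipulation
      swing {x} {y} x≻y y-at-ss x-at-ρ = reduce (nearby₁ (inj₂
        (deviation f (lead y x ∷ ss) (lead y x ∷ ρ x)
          (agree-cons (ss~ρ x)) x-at-ρ y-at-ss x≻y)))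

      result : NearManipulation
      result = reduce do
        c-at-ca ← keepsC c≢a
        c-at-cb ← keepsC c≢b
        a-at-ρa ← chain a≢b c≢a c≢b followsA c-at-cb
        b-at-ρb ← chain (≢-sym a≢b) c≢b c≢a followsB c-at-ca
        b-at-ss ← followsB (lead b a) (lead-above₁ (≢-sym a≢b) a≢b)
        a-at-ss ← followsA (lead a b) (lead-above₁ a≢b (≢-sym a≢b))
        pure ([ (λ a≻b → swing a≻b b-at-ss a-at-ρa) , (λ b≻a → swing b≻a a-at-ss b-at-ρb) ]′
                (above-total (lookup ss j) a≢b))

    -- The outcome of π, or of π with voter 1 switched to
    -- q₀, is either a third alternative or part of an a/b exchange by voter i,
    -- since a would put π into B₁^{a,b}(z) and b at the latter profile likewise.
    boundaryStep : ∀ {z i π} → InF a b z σ → InF a b z π → ¬ InB1 two≤n f a b z π →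
      AgreeExcept i σ π → NearManipulation
    boundaryStep {z} {zero} {p₀ ∷ ps} Fσ Fπ π∉B₁ σ~π with agree-head⁻¹ σ~π
    ... | refl = [ byOutcome , id ]′ (outcomeAB p₀)
      where
      byOutcome : f (p₀ ∷ ss) ≡ a ⊎ f (p₀ ∷ ss) ≡ b → NearManipulation
      byOutcome (inj₁ fa) = ⊥-elim (π∉B₁ (Fπ , fa , q₀ ∷ ss , agree-head , fσ′))
      byOutcome (inj₂ fb) = settle zero ss ss (agree-refl ss) (agree-refl ss)
        (exchange f σ (p₀ ∷ ss) σ~π fσ fb (sameOrder {z = z} σ (p₀ ∷ ss) a≢b Fσ Fπ zero))
    boundaryStep {z} {suc j} {p₀ ∷ ps} Fσ Fπ π∉B₁ σ~π with agree-cons⁻¹ σ~π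
    ... | refl , ss~ps = viaVoter (agree-sym {P = ss} {ps} ss~ps)
      where
      viaVoter : AgreeExcept j ps ss → NearManipulation
      viaVoter ps~ss with classify (f (p₀ ∷ ps)) | classify (f (q₀ ∷ ps))
      ... | inj₂ (inj₂ (≢a , ≢b)) | _ = ThirdOutcome.result ps~ss refl ≢a ≢b
      ... | inj₂ (inj₁ fb) | _ = settle j ss ps (agree-refl ss) ps~ss
        (exchange f σ (p₀ ∷ ps) σ~π fσ fb (sameOrder {z = z} σ (p₀ ∷ ps) a≢b Fσ Fπ (suc j)))
      ... | inj₁ fa | inj₂ (inj₁ fb) = ⊥-elim (π∉B₁ (Fπ , fa , q₀ ∷ ps , agree-head , fb))
      ... | inj₁ _  | inj₂ (inj₂ (≢a , ≢b)) = ThirdOutcome.result ps~ss refl ≢a ≢b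
      ... | inj₁ _  | inj₁ fa′ = settle j ps ss ps~ss (agree-refl ss)
        (exchange f (q₀ ∷ ps) (q₀ ∷ ss) (agree-cons {r = q₀} {ps} {ss} ps~ss) fa′ fσ′
          (sameOrder {z = z} (p₀ ∷ ps) σ a≢b Fπ Fσ (suc j)))

  thirdFixed? : ∀ c → (c ≡ a ⊎ c ≡ b ⊎ topOutcome c ≢ c) ⊎ ∃[ c ] (c ≢ a × c ≢ b × topOutcome c ≡ c)
  thirdFixed? c with classify c | topOutcome c ≟ c
  ... | inj₁ c≡a                | _          = inj₁ (inj₁ c≡a)
  ... | inj₂ (inj₁ c≡b)         | _          = inj₁ (inj₂ (inj₁ c≡b))
  ... | inj₂ (inj₂ _)           | no unfixed = inj₁ (inj₂ (inj₂ unfixed))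
  ... | inj₂ (inj₂ (c≢a , c≢b)) | yes fixed  = inj₂ (c , c≢a , c≢b , fixed)

  conclusion : ∀ {z i π} → InF a b z σ → InF a b z π → ¬ InB1 two≤n f a b z π →
    AgreeExcept i σ π → InD1 two≤n f a b σ ⊎ NearManipulation
  conclusion {z} {i} {π} Fσ Fπ π∉B₁ σ~π
    with search-Fin _ (λ c → c ≡ a ⊎ c ≡ b ⊎ topOutcome c ≢ c) thirdFixed?
  ... | inj₁ noThird                 = inj₂ (TwoValued.boundaryStep noThird {z} {i} {π} Fσ Fπ π∉B₁ σ~π)
  ... | inj₂ (c , c≢a , c≢b , fixed) = dictatorial c≢a c≢b fixed

lemma3p7 : ∀ (n k : ℕ) (h : 2 ≤ n) → 3 ≤ k → (ε : ℚ) → 0ℚ < ε →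
    (f : SCF n k) → DistNonManipAtLeast f ε →
    (a b : Fin k) → a ≢ b →
    (σ : Profile n k) → (∃[ z ] InBoundaryB1 h f a b z σ) →
    InD1 h f a b σ
    ⊎ (∃[ σ̂ ] (ManipulationPoint f σ̂ ×
         (∃[ j ] (∀ m → m ≢ first h → m ≢ j → lookup σ̂ m ≡ lookup σ m))))
lemma3p7 _ _ (s≤s (s≤s z≤n)) (s≤s (s≤s (s≤s z≤n))) _ _ f _ a b a≢b (s₀ ∷ ss)
  (z , (Fσ , fσ , q₀ ∷ qs , σ~σ′ , fσ′) , π , Fπ , π∉B₁ , i , σ~π , _) =
  Boundary.conclusion f a≢b s₀ q₀ ss fσ fσ′-at-ss {z} {i} {π} Fσ Fπ π∉B₁ σ~π
  where
  -- σ′ only changes the first voter of σ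
  fσ′-at-ss : f (q₀ ∷ ss) ≡ b
  fσ′-at-ss = subst (λ P → f (q₀ ∷ P) ≡ b) (sym (agree-head⁻¹ {r = s₀} {q₀} {ss} {qs} σ~σ′)) fσ′
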